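{- Let $L$ be a complete lattice, $F\colon L\to L$ an $\omega$-continuous function, and $\alpha\in L$. The algorithm LT-PDR (described in the context) is sound: if a run of LT-PDR on $(L,F,\alpha)$ outputs `True', then $\mu F\le\alpha$; and if it outputs `False', then $\mu F\not\le\alpha$.
   Context: $\omega$-continuous means preserving suprema of increasing $\omega$-chains (such $F$ is monotone); $\mu F$ is the least fixed point of $F$. A KT sequence is a finite chain $X=(X_0\le\cdots\le X_{n-1})$ in $L$ with $n\ge 2$, $X_{n-2}\le\alpha$ and $FX_i\le X_{i+1}$ for all $0\le i\le n-2$; it is conclusive if $X_{j+1}\le X_j$ for some $j$. A Kleene sequence (indexed from $i$) is a finite sequence $(C_i,\dots,C_{n-1})$ ($0\le i\le n$; empty if $i=n$) with $C_j\le FC_{j-1}$ for $i+1\le j\le n-1$ and $C_{n-1}\not\le\alpha$ (if nonempty); it is conclusive if it starts at index $0$ and $C_0=\bot$. LT-PDR: its data is a pair $(X;C)$ where $X=(X_0\le\cdots\le X_{n-1})$ and $C=(C_i,\dots,C_{n-1})$ (empty if $i=n$). Initially $(X;C)=(\bot\le F\bot;\ ())$. It repeatedly applies, nondeterministically, one applicable rule among the following until a value is returned: Valid: if $X_{j+1}\le X_j$ for some $j<n-1$, return `True' (with $X$). Unfold: if $X_{n-1}\le\alpha$, set $(X;C):=(X_0\le\cdots\le X_{n-1}\le\top;\ ())$. Induction: if some $k\ge 2$ and $x\in L$ satisfy $X_k\not\le x$ and $F(X_{k-1}\wedge x)\le x$, replace $X_j$ by $X_j\wedge x$ for all $2\le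 j\le k$, keeping $C$. Candidate: if $C=()$ and $X_{n-1}\not\le\alpha$, choose $x\in L$ with $x\le X_{n-1}$ and $x\not\le\alpha$, and set $C:=(x)$ (indexed at $n-1$). Model: if $C_1$ is defined (i.e. $C$ is nonempty and $i\le 1$), return `False' (with $(\bot,C_1,\dots,C_{n-1})$). Decide: if $C_i\le FX_{i-1}$, choose $x\in L$ with $x\le X_{i-1}$ and $C_i\le Fx$, and set $C:=(x,C_i,\dots,C_{n-1})$ (now indexed from $i-1$). Conflict: if $C_i\not\le FX_{i-1}$, choose $x\in L$ with $C_i\not\le x$ and $F(X_{i-1}\wedge x)\le x$, replace $X_j$ by $X_j\wedge x$ for $2\le j\le i$, and set $C:=(C_{i+1},\dots,C_{n-1})$. -}

module Defs where

open import Level using (Level; _⊔_) renaming (suc to lsuc)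
open import Data.Nat as ℕ using (ℕ; zero; suc; _<_; _≤_; _≡ᵇ_; _≤ᵇ_)
open import Data.Bool using (Bool; true; false; if_then_else_; _∧_)
open import Data.Product using (Σ; _×_; _,_)
open import Relation.Binary.Core using (Rel)
open import Relation.Binary.PropositionalEquality using (_≡_)
open import Relation.Binary.Structures using (IsPartialOrder)
open import Relation.Binary.Lattice.Structures using (IsBoundedLattice)
open import Relation.Binary.Construct.Closure.ReflexiveTransitive using (Star)
open import Relation.Nullary using (¬_)
open import Relation.Unary using (Pred)

-- Binary meets/joins, top and bottom are given as fields (they are
-- uniquely determined in a complete lattice), together with suprema
-- of arbitrary subsets.

record CompleteLattice (c ℓ : Level) : Set (lsuc (c ⊔ ℓ)) where
  infixr 7 _⊓_
  infixr 6 _⊔ₗ_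
  infix 4 _⊑_
  field
    Carrier          : Set c
    _⊑_              : Rel Carrier ℓ
    _⊔ₗ_             : Carrier → Carrier → Carrier
    _⊓_              : Carrier → Carrier → Carrier
    ⊤                : Carrier
    ⊥                : Carrier
    isBoundedLattice : IsBoundedLattice _≡_ _⊑_ _⊔ₗ_ _⊓_ ⊤ ⊥
    ⨆                : Pred Carrier c → Carrier
    ⨆-upper          : ∀ (S : Pred Carrier c) x → S x → x ⊑ ⨆ S
    ⨆-least          : ∀ (S : Pred Carrier c) y → (∀ x → S x → x ⊑ y) → ⨆ S ⊑ y

  open IsBoundedLattice isBoundedLattice public
    using (isPartialOrder)

module _ {c ℓ : Level} (L : CompleteLattice c ℓ) where
  open CompleteLattice L

  IsIncreasingChain : (ℕ → Carrier) → Set ℓ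
  IsIncreasingChain f = ∀ n → f n ⊑ f (suc n)

  Image : (ℕ → Carrier) → Pred Carrier c
  Image f y = Σ ℕ λ n → f n ≡ y

  OmegaContinuous : (Carrier → Carrier) → Set (c ⊔ ℓ)
  OmegaContinuous F = ∀ (f : ℕ → Carrier) → IsIncreasingChain f →
    F (⨆ (Image f)) ≡ ⨆ (Image (λ n → F (f n)))

  IsLeastFixedPoint : (Carrier → Carrier) → Carrier → Set (c ⊔ ℓ)
  IsLeastFixedPoint F m = F m ≡ m × (∀ y → F y ≡ y → m ⊑ y)

  -- A state (X ; C) is encoded by
  --   n : ℕ            the length of X, X = (X 0 , … , X (n-1))
  --   X : ℕ → Carrier  (values at indices ≥ n are irrelevant)
  --   i : ℕ            the start index of C, C = (C i , … , C (n-1));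
  --                    C is empty iff i = n
  --   C : ℕ → Carrier  (values outside [i, n-1] are irrelevant)

  record State : Set c where
    constructor st
    field
      n : ℕ
      X : ℕ → Carrier
      i : ℕ
      C : ℕ → Carrier

  update : (ℕ → Carrier) → ℕ → Carrier → ℕ → Carrier
  update f k v j = if j ≡ᵇ k then v else f j

  meetUpto : (ℕ → Carrier) → ℕ → Carrier → ℕ → Carrier
  meetUpto X k x j = if (2 ≤ᵇ j) ∧ (j ≤ᵇ k) then X j ⊓ x else X j

  module LT-PDR (F : Carrier → Carrier) (α : Carrier) where

    -- initial state (X ; C) = (⊥ ≤ F⊥ ; ())
    initial : State
    initial = st 2 (update (λ _ → ⊥) 1 (F ⊥)) 2 (λ _ → ⊥)

    data _⟶_ : State → State → Set (c ⊔ ℓ) where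
      unfold : ∀ {n X i C} →
        X (ℕ.pred n) ⊑ α →
        st n X i C ⟶ st (suc n) (update X n ⊤) (suc n) C
      induction : ∀ {n X i C} k x →
        2 ≤ k → k < n →
        ¬ (X k ⊑ x) → F (X (ℕ.pred k) ⊓ x) ⊑ x →
        st n X i C ⟶ st n (meetUpto X k x) i C
      candidate : ∀ {n X C} x →
        ¬ (X (ℕ.pred n) ⊑ α) →
        x ⊑ X (ℕ.pred n) → ¬ (x ⊑ α) →
        st n X n C ⟶ st n X (ℕ.pred n) (update C (ℕ.pred n) x)
      decide : ∀ {n X j C} x →
        suc j < n →
        C (suc j) ⊑ F (X j) →
        x ⊑ X j → C (suc j) ⊑ F x →
        st n X (suc j) C ⟶ st n X j (update C j x)
      conflict : ∀ {n X j C} x →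
        suc j < n →
        ¬ (C (suc j) ⊑ F (X j)) →
        ¬ (C (suc j) ⊑ x) → F (X j ⊓ x) ⊑ x →
        st n X (suc j) C ⟶ st n (meetUpto X (suc j) x) (suc (suc j)) C

    Reachable : State → Set (c ⊔ ℓ)
    Reachable = Star _⟶_ initial

    ReturnsTrue : State → Set ℓ
    ReturnsTrue (st n X i C) = Σ ℕ λ j → suc j < n × X (suc j) ⊑ X j

    -- rule Model applies (returns False): C₁ is defined
    ReturnsFalse : State → Set
    ReturnsFalse (st n X i C) = i ≤ 1 × i < n

-- LT-PDR maintains two invariants. X stays a KT sequence (increasing, with
-- F X_j ⊑ X_{j+1} and X_j ⊑ α below the last index) with X_0 = ⊥ and
-- X_1 = F ⊥; C stays a Kleene sequence (C_{j+1} ⊑ F C_j and C_{n-1} ⋢ α)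
-- whose head C_i lies below X_i = F^i ⊥ when i ≤ 1. When Valid fires, X_j is
-- a prefixed point below α, and μF, the supremum of the Kleene chain F^n ⊥,
-- lies below every prefixed point. When Model fires, the Kleene condition
-- gives C_{n-1} ⊑ F^{n-1} ⊥ ⊑ μF, so μF ⊑ α would contradict C_{n-1} ⋢ α.
{-# OPTIONS --safe #-}
module Submission where

open import Defs
open import Level using (Level; _⊔_)
open import Data.Bool using (true; false; T; _∧_)
open import Data.Empty using (⊥-elim)
open import Data.Nat using (ℕ; zero; suc; pred; _<_; _≤_; _≡ᵇ_; _≤ᵇ_; z≤n; s≤s; s≤s⁻¹; NonZero; >-nonZero)
open import Data.Nat.Properties
open import Data.Nat.GeneralisedArithmetic using (fold)
open import Data.Product using (∃-syntax; _×_; _,_)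
open import Data.Sum using (inj₁; inj₂)
open import Function using (_∘_)
open import Relation.Binary.Core using (_Preserves_⟶_)
open import Relation.Binary.Structures using (IsPartialOrder)
open import Relation.Binary.Construct.Closure.ReflexiveTransitive using (Star; ε; _◅_)
open import Relation.Binary.Lattice.Structures using (IsBoundedLattice)
open import Relation.Binary.PropositionalEquality using (_≡_; _≢_; refl; sym; trans; cong; subst; subst₂)
open import Relation.Nullary using (¬_; yes; no)
open import Relation.Nullary.Reflects using (ofʸ; ofⁿ)

0<n⇒pred[n]<n : ∀ {n} → 0 < n → pred n < n
0<n⇒pred[n]<n {suc n} _ = n<1+n n

module _ {c ℓ : Level} (L : CompleteLattice c ℓ) where
  open CompleteLattice L
  open IsBoundedLattice isBoundedLattice
    using (maximum; minimum; x∧y≤x; x∧y≤y; ∧-greatest; antisym)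
    renaming (refl to ⊑-refl; trans to ⊑-trans)

  update-≡ : ∀ f k v → update L f k v k ≡ v
  update-≡ f k v with k ≡ᵇ k in eq
  ... | true  = refl
  ... | false = ⊥-elim (subst T eq (≡⇒≡ᵇ k k refl))

  update-≢ : ∀ f {k} v {j} → j ≢ k → update L f k v j ≡ f j
  update-≢ f {k} v {j} j≢k with j ≡ᵇ k in eq
  ... | true  = ⊥-elim (j≢k (≡ᵇ⇒≡ j k (subst T (sym eq) _)))
  ... | false = refl

  meetUpto-⊑ : ∀ X k x j → meetUpto L X k x j ⊑ X j
  meetUpto-⊑ X k x j with (2 ≤ᵇ j) ∧ (j ≤ᵇ k)
  ... | true  = x∧y≤x _ _
  ... | false = ⊑-refl

  meetUpto-⊑-bound : ∀ X {k} x {j} → 2 ≤ j → j ≤ k → meetUpto L X k x j ⊑ x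
  meetUpto-⊑-bound X {k} x {j} 2≤j j≤k
    with 2 ≤ᵇ j | ≤ᵇ-reflects-≤ 2 j | j ≤ᵇ k | ≤ᵇ-reflects-≤ j k
  ... | true  | _       | true  | _       = x∧y≤y _ _
  ... | true  | _       | false | ofⁿ j≰k = ⊥-elim (j≰k j≤k)
  ... | false | ofⁿ 2≰j | _     | _       = ⊥-elim (2≰j 2≤j)

  ⊑-meetUpto : ∀ X {k x j z} → z ⊑ X j → (2 ≤ j → j ≤ k → z ⊑ x) → z ⊑ meetUpto L X k x j
  ⊑-meetUpto X {k} {x} {j} z⊑Xj z⊑x
    with 2 ≤ᵇ j | ≤ᵇ-reflects-≤ 2 j | j ≤ᵇ k | ≤ᵇ-reflects-≤ j k
  ... | true  | ofʸ 2≤j | true  | ofʸ j≤k = ∧-greatest z⊑Xj (z⊑x 2≤j j≤k)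
  ... | true  | _       | false | _       = z⊑Xj
  ... | false | _       | _     | _       = z⊑Xj

  ω-continuous⇒monotone : ∀ F → OmegaContinuous L F → F Preserves _⊑_ ⟶ _⊑_
  ω-continuous⇒monotone F F-cont {a} {b} a⊑b =
    subst (F a ⊑_) (trans (sym (F-cont step step-increasing)) (cong F ⨆step≡b))
      (⨆-upper _ _ (0 , refl))
    where
    step : ℕ → Carrier
    step zero    = a
    step (suc _) = b
    step-increasing : IsIncreasingChain L step
    step-increasing zero    = a⊑b
    step-increasing (suc _) = ⊑-refl
    ⨆step≡b : ⨆ (Image L step) ≡ b
    ⨆step≡b = antisym
      (⨆-least _ b λ { _ (zero , refl) → a⊑b ; _ (suc _ , refl) → ⊑-refl })
      (⨆-upper _ b (1 , refl))

  module _ (F : Carrier → Carrier) (F-mono : F Preserves _⊑_ ⟶ _⊑_) where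

    iterate-increasing : IsIncreasingChain L (fold ⊥ F)
    iterate-increasing zero    = minimum _
    iterate-increasing (suc n) = F-mono (iterate-increasing n)

    iterate-⊑-prefixed : ∀ {p} → F p ⊑ p → ∀ n → fold ⊥ F n ⊑ p
    iterate-⊑-prefixed Fp⊑p zero    = minimum _
    iterate-⊑-prefixed Fp⊑p (suc n) = ⊑-trans (F-mono (iterate-⊑-prefixed Fp⊑p n)) Fp⊑p

  module _ (F : Carrier → Carrier) (F-cont : OmegaContinuous L F) where

    private
      F-mono = ω-continuous⇒monotone F F-cont

    ⨆-iterate-fixed : F (⨆ (Image L (fold ⊥ F))) ≡ ⨆ (Image L (fold ⊥ F))
    ⨆-iterate-fixed = trans (F-cont (fold ⊥ F) (iterate-increasing F F-mono)) (antisym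
      (⨆-least _ _ λ { _ (n , refl) → ⨆-upper _ _ (suc n , refl) })
      (⨆-least _ _ λ { _ (zero , refl) → minimum _ ; _ (suc n , refl) → ⨆-upper _ _ (n , refl) }))

    lfp-⊑-prefixed : ∀ {μ p} → IsLeastFixedPoint L F μ → F p ⊑ p → μ ⊑ p
    lfp-⊑-prefixed (_ , μ-least) Fp⊑p = ⊑-trans (μ-least _ ⨆-iterate-fixed)
      (⨆-least _ _ λ { _ (n , refl) → iterate-⊑-prefixed F F-mono Fp⊑p n })

  module LT-PDR-Invariant (F : Carrier → Carrier) (F-mono : F Preserves _⊑_ ⟶ _⊑_) (α : Carrier) where
    open LT-PDR L F α

    record IsKTSequence (n : ℕ) (X : ℕ → Carrier) : Set (c ⊔ ℓ) where
      field
        2≤n        : 2 ≤ n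
        X₀≡⊥       : X 0 ≡ ⊥
        X₁≡F⊥      : X 1 ≡ F ⊥
        increasing : ∀ j → suc j < n → X j ⊑ X (suc j)
        F-step     : ∀ j → suc j < n → F (X j) ⊑ X (suc j)
        below-α    : ∀ j → suc j < n → X j ⊑ α

      pred[n]<n : pred n < n
      pred[n]<n = 0<n⇒pred[n]<n (≤-trans (s≤s z≤n) 2≤n)

      monotone : ∀ {i j} → i ≤ j → j < n → X i ⊑ X j
      monotone {j = zero}  z≤n _ = ⊑-refl
      monotone {j = suc j} i≤j j<n with m≤n⇒m<n∨m≡n i≤j
      ... | inj₁ i<1+j = ⊑-trans (monotone (s≤s⁻¹ i<1+j) (<⇒≤ j<n)) (increasing j j<n)
      ... | inj₂ refl  = ⊑-refl

      X≡iterate : ∀ {i} → i ≤ 1 → X i ≡ fold ⊥ F i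
      X≡iterate z≤n       = X₀≡⊥
      X≡iterate (s≤s z≤n) = X₁≡F⊥

    open IsKTSequence

    unfold-KT : ∀ {n X} → IsKTSequence n X → X (pred n) ⊑ α → IsKTSequence (suc n) (update L X n ⊤)
    unfold-KT {n} {X} kt Xₙ₋₁⊑α = record
      { 2≤n        = m≤n⇒m≤1+n (2≤n kt)
      ; X₀≡⊥       = trans (unchanged (≤-trans (s≤s z≤n) (2≤n kt))) (X₀≡⊥ kt)
      ; X₁≡F⊥      = trans (unchanged (2≤n kt)) (X₁≡F⊥ kt)
      ; increasing = λ j j<n → extended j {_⊑_} (s≤s⁻¹ j<n) (increasing kt j) (λ _ → maximum _)
      ; F-step     = λ j j<n → extended j {λ a b → F a ⊑ b} (s≤s⁻¹ j<n) (F-step kt j) (λ _ → maximum _)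
      ; below-α    = λ j j<n → extended j {λ a _ → a ⊑ α} (s≤s⁻¹ j<n) (below-α kt j) (λ { refl → Xₙ₋₁⊑α })
      }
      where
      X′ : ℕ → Carrier
      X′ = update L X n ⊤
      unchanged : ∀ {j} → j < n → X′ j ≡ X j
      unchanged j<n = update-≢ X ⊤ (<⇒≢ j<n)
      extended : ∀ j {R : Carrier → Carrier → Set ℓ} → suc j ≤ n →
        (suc j < n → R (X j) (X (suc j))) → (suc j ≡ n → R (X j) ⊤) → R (X′ j) (X′ (suc j))
      extended j 1+j≤n old new with m≤n⇒m<n∨m≡n 1+j≤n
      ... | inj₁ 1+j<n rewrite unchanged 1+j<n | unchanged (<⇒≤ 1+j<n) = old 1+j<n
      ... | inj₂ refl  rewrite unchanged (n<1+n j) | update-≡ X (suc j) ⊤ = new refl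

    strengthen-KT : ∀ {n X k x} → IsKTSequence n X → k < n → F (X (pred k) ⊓ x) ⊑ x →
      IsKTSequence n (meetUpto L X k x)
    strengthen-KT {n} {X} {k} {x} kt k<n F[Xₖ₋₁⊓x]⊑x = record
      { 2≤n        = 2≤n kt
      ; X₀≡⊥       = X₀≡⊥ kt
      ; X₁≡F⊥      = X₁≡F⊥ kt
      ; increasing = λ j j<n → ⊑-meetUpto X (⊑-trans (meetUpto-⊑ X k x j) (increasing kt j j<n))
          λ 2≤1+j 1+j≤k → X′⊑x (s≤s⁻¹ 2≤1+j) 1+j≤k
      ; F-step     = λ j j<n → ⊑-meetUpto X (⊑-trans (F-mono (meetUpto-⊑ X k x j)) (F-step kt j j<n))
          λ 2≤1+j 1+j≤k → ⊑-trans (F-mono (X′⊑Xₖ₋₁⊓x (s≤s⁻¹ 2≤1+j) 1+j≤k)) F[Xₖ₋₁⊓x]⊑x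
      ; below-α    = λ j j<n → ⊑-trans (meetUpto-⊑ X k x j) (below-α kt j j<n)
      }
      where
      X′ : ℕ → Carrier
      X′ = meetUpto L X k x
      X′⊑x : ∀ {j} → 1 ≤ j → j < k → X′ j ⊑ x
      X′⊑x {1}           _ _   = subst (_⊑ x) (sym (X₁≡F⊥ kt))
        (⊑-trans (F-mono (minimum _)) F[Xₖ₋₁⊓x]⊑x)
      X′⊑x {suc (suc j)} _ j<k = meetUpto-⊑-bound X x (s≤s (s≤s z≤n)) (<⇒≤ j<k)
      X′⊑Xₖ₋₁⊓x : ∀ {j} → 1 ≤ j → j < k → X′ j ⊑ X (pred k) ⊓ x
      X′⊑Xₖ₋₁⊓x {j} 1≤j j<k = ∧-greatest
        (⊑-trans (meetUpto-⊑ X k x j) (monotone kt (<⇒≤pred j<k) (≤-<-trans pred[n]≤n k<n)))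
        (X′⊑x 1≤j j<k)

    record IsKleeneSequence (n i : ℕ) (C : ℕ → Carrier) : Set (c ⊔ ℓ) where
      field
        step   : ∀ j → i < j → j < n → C j ⊑ F (C (pred j))
        last⋢α : i < n → ¬ C (pred n) ⊑ α
        start  : i ≤ 1 → C i ⊑ fold ⊥ F i

      ⊑iterate : i ≤ 1 → ∀ {j} → i ≤ j → j < n → C j ⊑ fold ⊥ F j
      ⊑iterate i≤1 {j} i≤j j<n with m≤n⇒m<n∨m≡n i≤j
      ... | inj₂ refl = start i≤1
      ⊑iterate i≤1 {suc j} _ j<n | inj₁ i<1+j =
        ⊑-trans (step (suc j) i<1+j j<n) (F-mono (⊑iterate i≤1 (s≤s⁻¹ i<1+j) (<⇒≤ j<n)))

    open IsKleeneSequence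

    empty-Kleene : ∀ {n C} → 2 ≤ n → IsKleeneSequence n n C
    empty-Kleene 2≤n = record
      { step   = λ _ n<j j<n → ⊥-elim (<-asym n<j j<n)
      ; last⋢α = λ n<n → ⊥-elim (<-irrefl refl n<n)
      ; start  = λ n≤1 → ⊥-elim (<-irrefl refl (≤-trans 2≤n n≤1))
      }

    candidate-Kleene : ∀ {n X C x} → IsKTSequence n X → x ⊑ X (pred n) → ¬ x ⊑ α →
      IsKleeneSequence n (pred n) (update L C (pred n) x)
    candidate-Kleene {n} {X} {C} {x} kt x⊑Xₙ₋₁ x⋢α = record
      { step   = λ _ n-1<j j<n → ⊥-elim (<⇒≱ n-1<j (<⇒≤pred j<n))
      ; last⋢α = λ _ → subst (λ y → ¬ y ⊑ α) (sym (update-≡ C (pred n) x)) x⋢α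
      ; start  = λ n-1≤1 → subst₂ _⊑_ (sym (update-≡ C (pred n) x)) (X≡iterate kt n-1≤1) x⊑Xₙ₋₁
      }

    decide-Kleene : ∀ {n X j C x} → IsKTSequence n X → IsKleeneSequence n (suc j) C →
      suc j < n → x ⊑ X j → C (suc j) ⊑ F x → IsKleeneSequence n j (update L C j x)
    decide-Kleene {n} {X} {j} {C} {x} kt ks 1+j<n x⊑Xⱼ Cⱼ₊₁⊑Fx = record
      { step   = step′
      ; last⋢α = λ _ → subst (λ y → ¬ y ⊑ α) (sym (update-≢ C x n-1≢j)) (last⋢α ks 1+j<n)
      ; start  = λ j≤1 → subst₂ _⊑_ (sym (update-≡ C j x)) (X≡iterate kt j≤1) x⊑Xⱼ
      }
      where
      instance
        n≢0 : NonZero n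
        n≢0 = >-nonZero (≤-trans (s≤s z≤n) 1+j<n)
      C′ : ℕ → Carrier
      C′ = update L C j x
      n-1≢j : pred n ≢ j
      n-1≢j n-1≡j = <⇒≱ 1+j<n (subst (_≤ suc j) (suc-pred n) (s≤s (≤-reflexive n-1≡j)))
      step′ : ∀ l → j < l → l < n → C′ l ⊑ F (C′ (pred l))
      step′ (suc l) j<1+l l<n with l ≟ j
      ... | yes refl rewrite update-≢ C x (<⇒≢ (n<1+n l) ∘ sym) | update-≡ C l x = Cⱼ₊₁⊑Fx
      ... | no l≢j rewrite update-≢ C x (<⇒≢ j<1+l ∘ sym) | update-≢ C x l≢j =
        step ks (suc l) (s≤s (≤∧≢⇒< (s≤s⁻¹ j<1+l) (l≢j ∘ sym))) l<n

    conflict-Kleene : ∀ {n i C} → 1 ≤ i → IsKleeneSequence n i C → IsKleeneSequence n (suc i) C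
    conflict-Kleene 1≤i ks = record
      { step   = λ j 1+i<j j<n → step ks j (<-trans (n<1+n _) 1+i<j) j<n
      ; last⋢α = λ 1+i<n → last⋢α ks (<-trans (n<1+n _) 1+i<n)
      ; start  = λ 1+i≤1 → ⊥-elim (<-irrefl refl (≤-trans (s≤s 1≤i) 1+i≤1))
      }

    Invariant : State L → Set (c ⊔ ℓ)
    Invariant (st n X i C) = IsKTSequence n X × IsKleeneSequence n i C

    initial-invariant : Invariant initial
    initial-invariant = kt , empty-Kleene ≤-refl
      where
      kt : IsKTSequence 2 (update L (λ _ → ⊥) 1 (F ⊥))
      kt = record
        { 2≤n        = ≤-refl
        ; X₀≡⊥       = refl
        ; X₁≡F⊥      = refl
        ; increasing = λ { zero _ → minimum _ ; (suc _) (s≤s (s≤s ())) }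
        ; F-step     = λ { zero _ → ⊑-refl ; (suc _) (s≤s (s≤s ())) }
        ; below-α    = λ { zero _ → minimum _ ; (suc _) (s≤s (s≤s ())) }
        }

    -- The negative side conditions of the rules only serve progress.
    step-invariant : ∀ {s t} → s ⟶ t → Invariant s → Invariant t
    step-invariant (unfold Xₙ₋₁⊑α) (kt , _) =
      unfold-KT kt Xₙ₋₁⊑α , empty-Kleene (m≤n⇒m≤1+n (2≤n kt))
    step-invariant (induction k x _ k<n _ F[Xₖ₋₁⊓x]⊑x) (kt , ks) =
      strengthen-KT kt k<n F[Xₖ₋₁⊓x]⊑x , ks
    step-invariant (candidate x _ x⊑Xₙ₋₁ x⋢α) (kt , _) =
      kt , candidate-Kleene kt x⊑Xₙ₋₁ x⋢α
    step-invariant (decide x 1+j<n _ x⊑Xⱼ Cⱼ₊₁⊑Fx) (kt , ks) =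
      kt , decide-Kleene kt ks 1+j<n x⊑Xⱼ Cⱼ₊₁⊑Fx
    step-invariant (conflict x 1+j<n _ _ F[Xⱼ⊓x]⊑x) (kt , ks) =
      strengthen-KT kt 1+j<n F[Xⱼ⊓x]⊑x , conflict-Kleene (s≤s z≤n) ks

    reachable⇒invariant : ∀ {s} → Reachable s → Invariant s
    reachable⇒invariant = go initial-invariant
      where
      go : ∀ {s t} → Invariant s → Star _⟶_ s t → Invariant t
      go inv ε            = inv
      go inv (step ◅ run) = go (step-invariant step inv) run

    valid-sound : ∀ {s} → Invariant s → ReturnsTrue s → ∃[ p ] F p ⊑ p × p ⊑ α
    valid-sound {st n X i C} (kt , _) (j , 1+j<n , Xⱼ₊₁⊑Xⱼ) =
      X j , ⊑-trans (F-step kt j 1+j<n) Xⱼ₊₁⊑Xⱼ , below-α kt j 1+j<n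

    model-sound : ∀ {s} → Invariant s → ReturnsFalse s → ∀ {p} → F p ⊑ p → ¬ p ⊑ α
    model-sound {st n X i C} (kt , ks) (i≤1 , i<n) Fp⊑p p⊑α = last⋢α ks i<n
      (⊑-trans (⊑iterate ks i≤1 (<⇒≤pred i<n) (pred[n]<n kt))
        (⊑-trans (iterate-⊑-prefixed F F-mono Fp⊑p (pred n)) p⊑α))

theorem7 : ∀ {c ℓ : Level} (L : CompleteLattice c ℓ) →
    let open CompleteLattice L in
    (F : Carrier → Carrier) → OmegaContinuous L F → (α : Carrier) →
    let open LT-PDR L F α in
    ∀ (s : State L) → Reachable s →
    (ReturnsTrue s → ∀ μF → IsLeastFixedPoint L F μF → μF ⊑ α) ×
    (ReturnsFalse s → ∀ μF → IsLeastFixedPoint L F μF → ¬ (μF ⊑ α))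
theorem7 L F F-cont α s reachable =
    (λ valid μF μF-lfp → let p , Fp⊑p , p⊑α = valid-sound invariant valid in
      ⊑-trans (lfp-⊑-prefixed L F F-cont μF-lfp Fp⊑p) p⊑α)
  , (λ model μF (Fμ≡μ , _) → model-sound invariant model (⊑-reflexive Fμ≡μ))
  where
  open CompleteLattice L using (isPartialOrder)
  open IsPartialOrder isPartialOrder using () renaming (trans to ⊑-trans; reflexive to ⊑-reflexive)
  open LT-PDR-Invariant L F (ω-continuous⇒monotone L F F-cont) α
  invariant : Invariant s
  invariant = reachable⇒invariant reachable
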